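{- Let $c$ be an exact $r$-coloring of $[n]$ that does not have a rainbow $3$-AP. For $i\in[r]$, let $b_i\in[n]$ be the least $x$ such that the restriction of $c$ to $[x]$ uses exactly $i$ colors. Then $b_{i+1}\geq 2b_i$ for all $i\in[r-1]$, and $b_j\geq 2^{j-i}b_i$ for all $1\le i\le j\le r$.
   Context: $[m]=\{1,\dots,m\}$. An exact $r$-coloring of $[n]$ is a surjective map $[n]\to[r]$. A $3$-AP is a set $\{a,a+d,a+2d\}\subseteq[n]$ with $d\ge1$; it is rainbow if its three elements have distinct colors. -}

module Defs where

open import Data.Nat using (ℕ; zero; suc; _+_; _*_; _≤_; _<_; _≟_)
open import Data.List using (List; []; _∷_; length; filter; map)
open import Data.List.Relation.Unary.Any using (any?)
open import Data.Product using (_×_; ∃)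
open import Relation.Binary.PropositionalEquality using (_≡_; _≢_)
open import Relation.Nullary using (¬_)

range : ℕ → List ℕ
range zero = []
range (suc m) = suc m ∷ range m

-- A colouring is c : ℕ → ℕ; only its values on [n] matter.
-- c is an exact r-colouring of [n]: maps [n] into [r] and is onto [r].
IsExactColoring : ℕ → ℕ → (ℕ → ℕ) → Set
IsExactColoring n r c =
  (∀ x → 1 ≤ x → x ≤ n → 1 ≤ c x × c x ≤ r) ×
  (∀ k → 1 ≤ k → k ≤ r → ∃ λ x → 1 ≤ x × x ≤ n × c x ≡ k)

HasRainbow3AP : ℕ → (ℕ → ℕ) → Set
HasRainbow3AP n c =
  ∃ λ a → ∃ λ d → 1 ≤ a × 1 ≤ d × a + 2 * d ≤ n ×
    c a ≢ c (a + d) × c a ≢ c (a + 2 * d) × c (a + d) ≢ c (a + 2 * d)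

-- number of distinct colours used by c on [x]
-- (the colours are assumed to lie in [r], so we count colours k ∈ [r] that occur)
numColors : ℕ → (ℕ → ℕ) → ℕ → ℕ
numColors r c x = length (filter (λ k → any? (λ y → c y ≟ k) (range x)) (range r))

IsLeastWithColors : ℕ → ℕ → (ℕ → ℕ) → ℕ → ℕ → Set
IsLeastWithColors n r c i b =
  1 ≤ b × b ≤ n × numColors r c b ≡ i ×
  (∀ x → 1 ≤ x → x < b → numColors r c x ≢ i)

module Submission where

-- Write NewColorAt c x when c x differs from every colour on [x-1].
-- If b is the least x such that c uses exactly i colours on [x], then c b is
-- such a new colour, and least points for more colours lie strictly further
-- right.  Now let x < y both carry new colours and suppose y < 2x.  Then with
-- d = y - x and a = x - d ≥ 1 the progression a, x, y lies in [n], and it is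
-- rainbow: c x ≠ c a because c x is new, and c y differs from c a and c x
-- because c y is new.  Hence without rainbow 3-APs consecutive least points
-- satisfy b(i+1) ≥ 2 b(i), and iterating gives b(j) ≥ 2^(j-i) b(i).

open import Defs
open import Data.Nat using (ℕ; zero; suc; _+_; _*_; _^_; _∸_; _≤_; _≥_; _<_; _≟_; z≤n; s≤s)
open import Data.Nat.Properties
open import Data.Nat.Solver using (module +-*-Solver)
open import Data.Product using (_×_; _,_; ∃; proj₁; proj₂)
open import Data.List using (length; filter)
open import Data.List.Relation.Unary.Any using (Any; here; there; any?)
open import Data.List.Relation.Binary.Sublist.Propositional using (⊆-refl)
open import Data.List.Relation.Binary.Sublist.Propositional.Properties using (filter⁺)
open import Data.List.Relation.Binary.Sublist.Heterogeneous.Properties using (length-mono-≤)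
open import Relation.Nullary using (¬_; yes; no)
open import Relation.Unary using (Pred; Decidable)
open import Level using (0ℓ)
open import Relation.Binary.PropositionalEquality
open import Data.Empty using (⊥-elim)
open import Function using (_∘′_)
open +-*-Solver

any-range⁺ : {P : Pred ℕ 0ℓ} → ∀ x y → 1 ≤ y → y ≤ x → P y → Any P (range x)
any-range⁺ zero    zero () z≤n p
any-range⁺ (suc x) y 1≤y y≤x p with y ≟ suc x
... | yes refl = here p
... | no y≢x   = there (any-range⁺ x y 1≤y (≤-pred (≤∧≢⇒< y≤x y≢x)) p)

any-range⁻ : {P : Pred ℕ 0ℓ} → ∀ x → Any P (range x) → ∃ λ y → 1 ≤ y × y ≤ x × P y
any-range⁻ (suc x) (here p)  = suc x , s≤s z≤n , ≤-refl , p
any-range⁻ (suc x) (there a) with any-range⁻ x a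
... | y , 1≤y , y≤x , p = y , 1≤y , m≤n⇒m≤1+n y≤x , p

NewColorAt : (ℕ → ℕ) → ℕ → Set
NewColorAt c x = ∀ z → 1 ≤ z → z < x → c z ≢ c x

module ColorCount (r : ℕ) (c : ℕ → ℕ) where

  occurs? : ∀ x → Decidable (λ k → Any (λ y → c y ≡ k) (range x))
  occurs? x k = any? (λ y → c y ≟ k) (range x)

  colors-mono : ∀ {x x'} → x ≤ x' → numColors r c x ≤ numColors r c x'
  colors-mono {x} {x'} x≤x' =
    length-mono-≤ (filter⁺ (occurs? x) (occurs? x') used (⊆-refl {x = range r}))
    where
    used : ∀ {k k'} → k ≡ k' → Any (λ y → c y ≡ k) (range x) → Any (λ y → c y ≡ k') (range x')
    used refl a with any-range⁻ x a
    ... | y , 1≤y , y≤x , p = any-range⁺ x' y 1≤y (≤-trans y≤x x≤x') p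

  colors-repeat : ∀ {x z} → 1 ≤ z → z ≤ x → c z ≡ c (suc x) →
                  numColors r c (suc x) ≡ numColors r c x
  colors-repeat {x} {z} 1≤z z≤x same =
    ≤-antisym (length-mono-≤ (filter⁺ (occurs? (suc x)) (occurs? x) used (⊆-refl {x = range r})))
              (colors-mono (n≤1+n x))
    where
    used : ∀ {k k'} → k ≡ k' → Any (λ y → c y ≡ k) (range (suc x)) → Any (λ y → c y ≡ k') (range x)
    used refl (here p)  = any-range⁺ x z 1≤z z≤x (trans same p)
    used refl (there a) = a

  least⇒new : ∀ {n i b} → IsLeastWithColors n r c i b → NewColorAt c b
  least⇒new {b = suc b} (_ , _ , count≡i , minimal) z 1≤z (s≤s z≤b) same =
    minimal b (≤-trans 1≤z z≤b) ≤-refl (trans (sym (colors-repeat 1≤z z≤b same)) count≡i)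

  least-increasing : ∀ {n i j b b'} → i < j →
    IsLeastWithColors n r c i b → IsLeastWithColors n r c j b' → b < b'
  least-increasing {b = b} {b'} i<j (_ , _ , count≡i , _) (_ , _ , count≡j , _) with b <? b'
  ... | yes b<b' = b<b'
  ... | no b≮b'  = ⊥-elim (<⇒≱ i<j (subst₂ _≤_ count≡j count≡i (colors-mono (≮⇒≥ b≮b'))))

room-below : ∀ x e → suc x + e < 2 * x → suc (suc e) ≤ x
room-below x e = +-cancelˡ-≤ x _ _ ∘′ subst₂ _≤_
  (solve 2 (λ x e → con 2 :+ x :+ e := x :+ (con 2 :+ e)) refl x e)
  (solve 1 (λ x → con 2 :* x := x :+ x) refl x)

-- If x < y < 2x then a, x, y is a 3-AP with a ≥ 1: writing y = x + 1 + e and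
-- (by room-below) x = (e + 2) + f, take d = e + 1 and a = f + 1.
ap-ending-at : ∀ {x y} → x < y → y < 2 * x →
  ∃ λ a → ∃ λ d → 1 ≤ a × 1 ≤ d × a + d ≡ x × a + 2 * d ≡ y
ap-ending-at x<y y<2x with m≤n⇒∃[o]m+o≡n x<y
... | e , refl with m≤n⇒∃[o]m+o≡n (room-below _ e y<2x)
... | f , refl = suc f , suc e , s≤s z≤n , s≤s z≤n ,
  solve 2 (λ e f → (con 1 :+ f) :+ (con 1 :+ e) := (con 2 :+ e) :+ f) refl e f ,
  solve 2 (λ e f → (con 1 :+ f) :+ con 2 :* (con 1 :+ e)
                   := (con 1 :+ ((con 2 :+ e) :+ f)) :+ e) refl e f

-- Doubling lemma: without rainbow 3-APs, two new colours at x < y ≤ n force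
-- y ≥ 2x, since otherwise the 3-AP ending in x, y is rainbow.
new-colors-double : ∀ {n c x y} → ¬ HasRainbow3AP n c → x < y → y ≤ n →
  NewColorAt c x → NewColorAt c y → 2 * x ≤ y
new-colors-double {x = x} {y} noRainbow x<y y≤n newX newY with 2 * x ≤? y
... | yes 2x≤y = 2x≤y
... | no 2x≰y with ap-ending-at x<y (≰⇒> 2x≰y)
... | a , d , 1≤a , 1≤d , refl , refl =
  ⊥-elim (noRainbow (a , d , 1≤a , 1≤d , y≤n ,
    newX a 1≤a a<x , newY a 1≤a (<-trans a<x x<y) , newY (a + d) (≤-trans 1≤a (<⇒≤ a<x)) x<y))
  where
  a<x : a < a + d
  a<x = m<m+n a 1≤d

doubling-chain : (b : ℕ → ℕ) {lo hi : ℕ} →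
  (∀ i → lo ≤ i → i + 1 ≤ hi → 2 * b i ≤ b (i + 1)) →
  ∀ i j → lo ≤ i → i ≤ j → j ≤ hi → 2 ^ (j ∸ i) * b i ≤ b j
doubling-chain b {lo} {hi} double i j lo≤i i≤j j≤hi with m≤n⇒∃[o]m+o≡n i≤j
... | k , refl = subst (λ t → 2 ^ t * b i ≤ b (i + k)) (sym (m+n∸m≡n i k)) (grow k j≤hi)
  where
  grow : ∀ k → i + k ≤ hi → 2 ^ k * b i ≤ b (i + k)
  grow zero    _     = subst (λ t → 1 * b i ≤ b t) (sym (+-identityʳ i)) (≤-reflexive (*-identityˡ (b i)))
  grow (suc k) i+1+k≤hi = begin
    2 ^ suc k * b i     ≡⟨ *-assoc 2 (2 ^ k) (b i) ⟩
    2 * (2 ^ k * b i)   ≤⟨ *-monoʳ-≤ 2 (grow k (≤-trans (+-monoʳ-≤ i (n≤1+n k)) i+1+k≤hi)) ⟩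
    2 * b (i + k)       ≤⟨ double (i + k) (≤-trans lo≤i (m≤m+n i k)) (subst (_≤ hi) (sym shift) i+1+k≤hi) ⟩
    b (i + k + 1)       ≡⟨ cong b shift ⟩
    b (i + suc k)       ∎
    where
    open ≤-Reasoning
    shift : i + k + 1 ≡ i + suc k
    shift = trans (+-assoc i k 1) (cong (i +_) (+-comm k 1))

lemma2p5 : (n r : ℕ) (c : ℕ → ℕ) → IsExactColoring n r c → ¬ HasRainbow3AP n c →
    (b : ℕ → ℕ) → (∀ i → 1 ≤ i → i ≤ r → IsLeastWithColors n r c i (b i)) →
    (∀ i → 1 ≤ i → i ≤ r ∸ 1 → b (i + 1) ≥ 2 * b i) ×
    (∀ i j → 1 ≤ i → i ≤ j → j ≤ r → b j ≥ 2 ^ (j ∸ i) * b i)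
lemma2p5 n r c _ noRainbow b least = doubles-below , doubling-chain b doubles
  where
  open ColorCount r c

  -- Consecutive least points carry new colours, so they double.
  doubles : ∀ i → 1 ≤ i → i + 1 ≤ r → 2 * b i ≤ b (i + 1)
  doubles i 1≤i i+1≤r = new-colors-double noRainbow
      (least-increasing (m<m+n i (s≤s z≤n)) leastᵢ leastᵢ₊₁) (proj₁ (proj₂ leastᵢ₊₁))
      (least⇒new leastᵢ) (least⇒new leastᵢ₊₁)
    where
    leastᵢ : IsLeastWithColors n r c i (b i)
    leastᵢ   = least i 1≤i (≤-trans (m≤m+n i 1) i+1≤r)
    leastᵢ₊₁ : IsLeastWithColors n r c (i + 1) (b (i + 1))
    leastᵢ₊₁ = least (i + 1) (≤-trans 1≤i (m≤m+n i 1)) i+1≤r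

  doubles-below : ∀ i → 1 ≤ i → i ≤ r ∸ 1 → 2 * b i ≤ b (i + 1)
  doubles-below i 1≤i i≤r-1 = doubles i 1≤i (m≤o∸n⇒m+n≤o i (≤-trans 1≤i (≤-trans i≤r-1 (m∸n≤m r 1))) i≤r-1)
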